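{- If $G$ is a classical type of $LM2$, then both $\vdash_{LAF2}\neg\neg G^*\rightarrow G^*$ and $\vdash_{LAF2}G^*\rightarrow\neg\neg G^*$.
   Context: Formulas: second-order predicate logic built from $\perp$ and atomic formulas $R(t_1,\dots,t_k)$ ($R$ a predicate symbol or predicate variable, $t_i$ first-order terms) with $\rightarrow,\forall x,\forall X$; $\neg A=A\rightarrow\perp$; equations $u=v:=\forall Y(Y(u)\rightarrow Y(v))$, a fixed set of equations. $LAF2$ is second-order intuitionistic natural deduction (hypothesis, $\rightarrow$-intro/elim, $\forall x$ and $\forall X$ intro (eigenvariable)/elim (any term/formula), equational rule from $A[u/x]$ and $u\approx v$ to $A[v/x]$). $LM2$-formulas may also contain classical predicate variables $X_C$. A formula ends with $X$ if it is $X(\vec t)$, or $A\rightarrow B$ with $B$ ending with $X$, or $\forall vA$ with $A$ ending with $X$; a classical type is a formula ending with $\perp$ or with a classical variable. Gödel translation: to each classical variable $X_C$ associate a fresh ordinary predicate variable $X^*$ of the same arity; $D(\vec t)^*=D(\vec t)$ for $D$ a predicate symbol, ordinary predicate variable, or $\perp$; $X_C(\vec t)^*=\neg X^*(\vec t)$; $(B\rightarrow D)^*=B^*\rightarrow D^*$; $(\forall xB)^*=\forall xB^*$; $(\forall XB)^*=\forall XB^*$; $(\forall X_CB)^*=\forall X^*B^*$. -}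

module Defs where

open import Data.Nat using (ℕ; zero; suc; _≡ᵇ_)
open import Data.Bool using (Bool; true; false; _∧_; if_then_else_)
open import Data.Fin using (toℕ)
open import Data.Vec using (Vec; []; _∷_; tabulate)
open import Data.List using (List; []; _∷_; map)
open import Data.List.Membership.Propositional using (_∈_)
open import Data.Sum using (_⊎_)

record Signature : Set₁ where
  field
    Fun  : ℕ → Set
    Pred : ℕ → Set
open Signature public

private
  variable
    S : Signature
    T : Set

data Term (S : Signature) : Set where
  var : ℕ → Term S
  fun : ∀ {k} → Fun S k → Vec (Term S) k → Term S

mutual
  substT : (ℕ → Term S) → Term S → Term S
  substT σ (var i)    = σ i
  substT σ (fun f ts) = fun f (substTs σ ts)

  substTs : ∀ {n} → (ℕ → Term S) → Vec (Term S) n → Vec (Term S) n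
  substTs σ []       = []
  substTs σ (t ∷ ts) = substT σ t ∷ substTs σ ts

_∷σ : Term S → ℕ → Term S
(u ∷σ) zero    = u
(u ∷σ) (suc j) = var j

liftσ : (ℕ → Term S) → ℕ → Term S
liftσ σ zero    = var zero
liftσ σ (suc i) = substT (λ j → var (suc j)) (σ i)

-- T is the set of "families" of predicate variables.
-- A predicate variable  pv k s i ts  has arity k, family s and
-- de Bruijn index i, counted among the binders  ∀₂ k s  (one namespace
-- per arity and family).  ∀₁ binds the first-order variable 0.

infixr 5 _⇒_
data Fm (S : Signature) (T : Set) : Set where
  ⊥ᶠ  : Fm S T
  rel : ∀ {k} → Pred S k → Vec (Term S) k → Fm S T
  pv  : (k : ℕ) → T → ℕ → Vec (Term S) k → Fm S T
  _⇒_ : Fm S T → Fm S T → Fm S T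
  ∀₁  : Fm S T → Fm S T
  ∀₂  : (k : ℕ) → T → Fm S T → Fm S T

¬ᶠ_ : Fm S T → Fm S T
¬ᶠ A = A ⇒ ⊥ᶠ

tsub : (ℕ → Term S) → Fm S T → Fm S T
tsub σ ⊥ᶠ           = ⊥ᶠ
tsub σ (rel r ts)   = rel r (substTs σ ts)
tsub σ (pv k s i ts) = pv k s i (substTs σ ts)
tsub σ (A ⇒ B)      = tsub σ A ⇒ tsub σ B
tsub σ (∀₁ A)       = ∀₁ (tsub (liftσ σ) A)
tsub σ (∀₂ k s A)   = ∀₂ k s (tsub σ A)

-- LAF2 formulas: only ordinary predicate variables.  They come in two
-- (disjoint, infinite) families of names: plain names X and starred
-- names X* (the latter are used as the fresh variables of the Goedel
-- translation).

data Fam : Set where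
  plain star : Fam

_≡ᶠ_ : Fam → Fam → Bool
plain ≡ᶠ plain = true
star  ≡ᶠ star  = true
_     ≡ᶠ _     = false

LAF2 : Signature → Set
LAF2 S = Fm S Fam

sameNS : ℕ → Fam → ℕ → Fam → Bool
sameNS k s k' s' = (k ≡ᵇ k') ∧ (s ≡ᶠ s')

PRen : Set
PRen = (k : ℕ) → Fam → ℕ → ℕ

liftρ : ℕ → Fam → PRen → PRen
liftρ k s ρ k' s' i with sameNS k s k' s'
... | false = ρ k' s' i
... | true with i
...   | zero  = zero
...   | suc j = suc (ρ k' s' j)

pren : PRen → LAF2 S → LAF2 S
pren ρ ⊥ᶠ            = ⊥ᶠ
pren ρ (rel r ts)    = rel r ts
pren ρ (pv k s i ts) = pv k s (ρ k s i) ts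
pren ρ (A ⇒ B)       = pren ρ A ⇒ pren ρ B
pren ρ (∀₁ A)        = ∀₁ (pren ρ A)
pren ρ (∀₂ k s A)    = ∀₂ k s (pren (liftρ k s ρ) A)

wk : ℕ → Fam → PRen
wk k s k' s' i = if sameNS k s k' s' then suc i else i

-- An abstraction λx₀…x_{k-1}. B of arity k is a formula B whose
-- first-order variables 0 … k-1 are the parameters and whose variable
-- k + j is the outer free variable j.
params : (k : ℕ) → Vec (Term S) k
params k = tabulate (λ j → var (toℕ j))

args : ∀ {k} → Vec (Term S) k → ℕ → Term S
args []       j       = var j
args (t ∷ ts) zero    = t
args (t ∷ ts) (suc j) = args ts j

above : ℕ → ℕ → ℕ
above zero    j       = suc j
above (suc k) zero    = zero
above (suc k) (suc j) = suc (above k j)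

PSub : Signature → Set
PSub S = (k : ℕ) → Fam → ℕ → LAF2 S

psub : PSub S → LAF2 S → LAF2 S
psub ρ ⊥ᶠ            = ⊥ᶠ
psub ρ (rel r ts)    = rel r ts
psub ρ (pv k s i ts) = tsub (args ts) (ρ k s i)
psub ρ (A ⇒ B)       = psub ρ A ⇒ psub ρ B
psub ρ (∀₁ A)        = ∀₁ (psub (λ k s i → tsub (λ j → var (above k j)) (ρ k s i)) A)
psub ρ (∀₂ k s A)    = ∀₂ k s (psub ρ' A)
  where
  ρ' : PSub _
  ρ' k' s' i with sameNS k s k' s'
  ... | false = pren (wk k s) (ρ k' s' i)
  ... | true with i
  ...   | zero  = pv k' s' zero (params k')
  ...   | suc j = pren (wk k s) (ρ k' s' j)

single : ℕ → Fam → LAF2 S → PSub S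
single k s B k' s' i with sameNS k s k' s'
... | false = pv k' s' i (params k')
... | true with i
...   | zero  = B
...   | suc j = pv k' s' j (params k')

data _⊨_≈_ {S : Signature} (E : Term S → Term S → Set) : Term S → Term S → Set where
  ax    : ∀ {u v} → E u v → (σ : ℕ → Term S) → E ⊨ substT σ u ≈ substT σ v
  refl≈ : ∀ {u} → E ⊨ u ≈ u
  sym≈  : ∀ {u v} → E ⊨ u ≈ v → E ⊨ v ≈ u
  trans≈ : ∀ {u v w} → E ⊨ u ≈ v → E ⊨ v ≈ w → E ⊨ u ≈ w
  ctx≈  : ∀ {u v} (t : Term S) → E ⊨ u ≈ v → E ⊨ substT (u ∷σ) t ≈ substT (v ∷σ) t

infix 2 _⨾_⊢_
data _⨾_⊢_ {S : Signature} (E : Term S → Term S → Set) : List (LAF2 S) → LAF2 S → Set where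
  hyp  : ∀ {Γ A} → A ∈ Γ → E ⨾ Γ ⊢ A
  ⇒I   : ∀ {Γ A B} → E ⨾ (A ∷ Γ) ⊢ B → E ⨾ Γ ⊢ A ⇒ B
  ⇒E   : ∀ {Γ A B} → E ⨾ Γ ⊢ A ⇒ B → E ⨾ Γ ⊢ A → E ⨾ Γ ⊢ B
  -- eigenvariable condition: the bound variable is fresh for Γ
  ∀₁I  : ∀ {Γ A} → E ⨾ map (tsub (λ j → var (suc j))) Γ ⊢ A → E ⨾ Γ ⊢ ∀₁ A
  ∀₁E  : ∀ {Γ A} → E ⨾ Γ ⊢ ∀₁ A → (t : Term S) → E ⨾ Γ ⊢ tsub (t ∷σ) A
  ∀₂I  : ∀ {Γ k s A} → E ⨾ map (pren (wk k s)) Γ ⊢ A → E ⨾ Γ ⊢ ∀₂ k s A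
  ∀₂E  : ∀ {Γ k s A} → E ⨾ Γ ⊢ ∀₂ k s A → (B : LAF2 S) → E ⨾ Γ ⊢ psub (single k s B) A
  eqR  : ∀ {Γ A u v} → E ⨾ Γ ⊢ tsub (u ∷σ) A → E ⊨ u ≈ v → E ⨾ Γ ⊢ tsub (v ∷σ) A

-- LM2 formulas: predicate variables are ordinary or classical (X_C)

data Kind : Set where
  ord cls : Kind

LM2 : Signature → Set
LM2 S = Fm S Kind

data EndsWith⊥ {S : Signature} : LM2 S → Set where
  bot : EndsWith⊥ ⊥ᶠ
  imp : ∀ {A B} → EndsWith⊥ B → EndsWith⊥ (A ⇒ B)
  all₁ : ∀ {A} → EndsWith⊥ A → EndsWith⊥ (∀₁ A)
  all₂ : ∀ {k c A} → EndsWith⊥ A → EndsWith⊥ (∀₂ k c A)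

data EndsWithCls {S : Signature} : LM2 S → Set where
  var  : ∀ {k i ts} → EndsWithCls (pv k cls i ts)
  imp  : ∀ {A B} → EndsWithCls B → EndsWithCls (A ⇒ B)
  all₁ : ∀ {A} → EndsWithCls A → EndsWithCls (∀₁ A)
  all₂ : ∀ {k c A} → EndsWithCls A → EndsWithCls (∀₂ k c A)

ClassicalType : LM2 S → Set
ClassicalType G = EndsWith⊥ G ⊎ EndsWithCls G

_* : LM2 S → LAF2 S
⊥ᶠ *              = ⊥ᶠ
rel r ts *        = rel r ts
pv k ord i ts *   = pv k plain i ts
pv k cls i ts *   = ¬ᶠ pv k star i ts
(A ⇒ B) *         = (A *) ⇒ (B *)
∀₁ A *            = ∀₁ (A *)
∀₂ k ord A *      = ∀₂ k plain (A *)
∀₂ k cls A *      = ∀₂ k star (A *)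

module Submission where

-- The second implication is double-negation introduction, valid for every
-- formula.  For the first, observe that the Goedel translation of a
-- classical type "ends with ⊥": a classical variable X_C(t) becomes
-- ¬X*(t) = X*(t) → ⊥.  Every formula ending with ⊥ is ¬¬-stable, by
-- induction on its shape: ⊥ is stable, and stability is preserved by
-- A → _, ∀x and ∀X.
--
-- The quantifier steps instantiate the hypothesis ¬¬∀v.A at its own
-- bound variable v, after the eigenvariable rule has weakened the
-- context.  That this instance is literally A again is a syntactic fact
-- about the de Bruijn substitutions of Defs, proved first: a first-order
-- and a second-order "cancellation" lemma, each saying that a renaming
-- followed by a substitution that undoes it pointwise leaves a formula
-- unchanged.

open import Defs
open import Data.List using ([]; List)
open import Data.Product using (_×_; _,_)

open import Data.Nat using (ℕ; zero; suc)
open import Data.Bool using (true; false; T; if_then_else_)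
open import Data.Bool.Properties using (T-≡; T-∧)
open import Data.Nat.Properties using (≡ᵇ⇒≡)
open import Data.Fin using (Fin; toℕ) renaming (zero to fzero; suc to fsuc)
open import Data.Vec using (Vec; []; _∷_; tabulate; lookup)
open import Data.Vec.Properties using (tabulate-cong; tabulate∘lookup)
open import Data.List.Relation.Unary.Any using (here; there)
open import Data.Sum using (inj₁; inj₂)
open import Function.Bundles using (Equivalence)
open import Relation.Binary.PropositionalEquality
  using (_≡_; refl; trans; cong; cong₂; module ≡-Reasoning)

private
  variable
    S : Signature
    V : Set

↑ : ℕ → Term S
↑ j = var (suc j)

mutual
  substT-cancel : {σ τ : ℕ → Term S} → (∀ i → substT σ (τ i) ≡ var i) →
                  ∀ t → substT σ (substT τ t) ≡ t
  substT-cancel p (var i)    = p i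
  substT-cancel p (fun f ts) = cong (fun f) (substTs-cancel p ts)

  substTs-cancel : ∀ {n} {σ τ : ℕ → Term S} → (∀ i → substT σ (τ i) ≡ var i) →
                   (ts : Vec (Term S) n) → substTs σ (substTs τ ts) ≡ ts
  substTs-cancel p []       = refl
  substTs-cancel p (t ∷ ts) = cong₂ _∷_ (substT-cancel p t) (substTs-cancel p ts)

mutual
  substT-liftσ-↑ : (σ : ℕ → Term S) → ∀ t →
                   substT (liftσ σ) (substT ↑ t) ≡ substT ↑ (substT σ t)
  substT-liftσ-↑ σ (var i)    = refl
  substT-liftσ-↑ σ (fun f ts) = cong (fun f) (substTs-liftσ-↑ σ ts)

  substTs-liftσ-↑ : ∀ {n} (σ : ℕ → Term S) (ts : Vec (Term S) n) →
                    substTs (liftσ σ) (substTs ↑ ts) ≡ substTs ↑ (substTs σ ts)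
  substTs-liftσ-↑ σ []       = refl
  substTs-liftσ-↑ σ (t ∷ ts) = cong₂ _∷_ (substT-liftσ-↑ σ t) (substTs-liftσ-↑ σ ts)

liftσ-cancel : {σ τ : ℕ → Term S} → (∀ i → substT σ (τ i) ≡ var i) →
               ∀ i → substT (liftσ σ) (liftσ τ i) ≡ var i
liftσ-cancel p zero = refl
liftσ-cancel {σ = σ} {τ} p (suc j) = begin
  substT (liftσ σ) (substT ↑ (τ j))  ≡⟨ substT-liftσ-↑ σ (τ j) ⟩
  substT ↑ (substT σ (τ j))          ≡⟨ cong (substT ↑) (p j) ⟩
  var (suc j)                        ∎
  where open ≡-Reasoning

tsub-cancel : {σ τ : ℕ → Term S} → (∀ i → substT σ (τ i) ≡ var i) →
              (A : Fm S V) → tsub σ (tsub τ A) ≡ A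
tsub-cancel p ⊥ᶠ            = refl
tsub-cancel p (rel r ts)    = cong (rel r) (substTs-cancel p ts)
tsub-cancel p (pv k s i ts) = cong (pv k s i) (substTs-cancel p ts)
tsub-cancel p (A ⇒ B)       = cong₂ _⇒_ (tsub-cancel p A) (tsub-cancel p B)
tsub-cancel p (∀₁ A)        = cong ∀₁ (tsub-cancel (liftσ-cancel p) A)
tsub-cancel p (∀₂ k s A)    = cong (∀₂ k s) (tsub-cancel p A)

∀₁-instance-self : (A : LAF2 S) → tsub (var zero ∷σ) (tsub (liftσ ↑) A) ≡ A
∀₁-instance-self = tsub-cancel λ { zero → refl ; (suc j) → refl }

substTs-tabulate : ∀ {n} (σ : ℕ → Term S) (f : Fin n → Term S) →
                   substTs σ (tabulate f) ≡ tabulate (λ j → substT σ (f j))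
substTs-tabulate {n = zero}  σ f = refl
substTs-tabulate {n = suc n} σ f =
  cong (substT σ (f fzero) ∷_) (substTs-tabulate σ (λ j → f (fsuc j)))

args-lookup : ∀ {n} (ts : Vec (Term S) n) (j : Fin n) → args ts (toℕ j) ≡ lookup ts j
args-lookup (t ∷ ts) fzero    = refl
args-lookup (t ∷ ts) (fsuc j) = args-lookup ts j

args-params : ∀ {n} (ts : Vec (Term S) n) → substTs (args ts) (params n) ≡ ts
args-params {n = n} ts = begin
  substTs (args ts) (params n)          ≡⟨ substTs-tabulate (args ts) _ ⟩
  tabulate (λ j → args ts (toℕ j))      ≡⟨ tabulate-cong (args-lookup ts) ⟩
  tabulate (lookup ts)                  ≡⟨ tabulate∘lookup ts ⟩
  ts                                    ∎
  where open ≡-Reasoning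

above-params-index : ∀ {n} (j : Fin n) → above n (toℕ j) ≡ toℕ j
above-params-index fzero    = refl
above-params-index (fsuc j) = cong suc (above-params-index j)

above-params : ∀ n → substTs {S = S} (λ j → var (above n j)) (params n) ≡ params n
above-params n =
  trans (substTs-tabulate _ _) (tabulate-cong (λ j → cong var (above-params-index j)))

≡ᶠ-sound : ∀ s s' → T (s ≡ᶠ s') → s ≡ s'
≡ᶠ-sound plain plain _ = refl
≡ᶠ-sound star  star  _ = refl

sameNS-sound : ∀ k s k' s' → sameNS k s k' s' ≡ true → k ≡ k' × s ≡ s'
sameNS-sound k s k' s' eq
  with Equivalence.to T-∧ (Equivalence.from T-≡ eq)
... | same-k , same-s = ≡ᵇ⇒≡ k k' same-k , ≡ᶠ-sound s s' same-s

pvar : ℕ → Fam → ℕ → LAF2 S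
pvar k s i = pv k s i (params k)

pvar-wk : ∀ k s k' s' i {b} → sameNS k s k' s' ≡ b →
          pvar {S = S} k' s' (wk k s k' s' i) ≡ pvar k' s' (if b then suc i else i)
pvar-wk k s k' s' i eq = cong (λ b → pvar k' s' (if b then suc i else i)) eq

-- In the ∀₂ case σ is replaced by the lifted
-- substitution built inside the ∀₂ clause of psub.  That function is local
-- to psub (it depends on σ, k, s and the body A) and cannot be named here,
-- so the type of the lifting step pren-lift-inverse leaves it to be
-- inferred from its single use.
Inverts : PSub S → PRen → Set
Inverts σ ρ = ∀ k s i → σ k s (ρ k s i) ≡ pvar k s i

psub-pren-cancel : (σ : PSub S) (ρ : PRen) → Inverts σ ρ → ∀ A → psub σ (pren ρ A) ≡ A
pren-lift-inverse : (σ : PSub S) (ρ : PRen) (k : ℕ) (s : Fam) (A : LAF2 S) →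
  Inverts σ ρ → ∀ k' s' i → _ ≡ pvar k' s' i

psub-pren-cancel σ ρ inv ⊥ᶠ            = refl
psub-pren-cancel σ ρ inv (rel r ts)    = refl
psub-pren-cancel σ ρ inv (pv k s i ts) =
  trans (cong (tsub (args ts)) (inv k s i)) (cong (pv k s i) (args-params ts))
psub-pren-cancel σ ρ inv (A ⇒ B) =
  cong₂ _⇒_ (psub-pren-cancel σ ρ inv A) (psub-pren-cancel σ ρ inv B)
psub-pren-cancel σ ρ inv (∀₁ A) = cong ∀₁ (psub-pren-cancel _ ρ inv↑ A)
  where
  inv↑ : ∀ k s i → tsub (λ j → var (above k j)) (σ k s (ρ k s i)) ≡ pvar k s i
  inv↑ k s i = trans (cong (tsub _) (inv k s i)) (cong (pv k s i) (above-params k))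
psub-pren-cancel σ ρ inv (∀₂ k s A) =
  cong (∀₂ k s) (psub-pren-cancel _ _ (pren-lift-inverse σ ρ k s A inv) A)

pren-lift-inverse σ ρ k s A inv k' s' i with sameNS k s k' s' in eq
... | false = trans (cong (pren (wk k s)) (inv k' s' i)) (pvar-wk k s k' s' i eq)
pren-lift-inverse σ ρ k s A inv k' s' zero    | true = refl
pren-lift-inverse σ ρ k s A inv k' s' (suc j) | true =
  trans (cong (pren (wk k s)) (inv k' s' j)) (pvar-wk k s k' s' j eq)

single-self-inverts : ∀ k s → Inverts {S = S} (single k s (pvar k s zero))
                                              (liftρ k s (wk k s))
single-self-inverts k s k' s' i with sameNS k s k' s' in eq
... | false = pvar-wk k s k' s' i eq
single-self-inverts k s k' s' zero | true with sameNS-sound k s k' s' eq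
... | refl , refl = refl
single-self-inverts k s k' s' (suc j) | true = pvar-wk k s k' s' j eq

∀₂-instance-self : ∀ k s (A : LAF2 S) →
  psub (single k s (pvar k s zero)) (pren (liftρ k s (wk k s)) A) ≡ A
∀₂-instance-self k s = psub-pren-cancel _ _ (single-self-inverts k s)

module _ {E : Term S → Term S → Set} where

  conv : {Γ : List (LAF2 S)} {A B : LAF2 S} → A ≡ B → E ⨾ Γ ⊢ A → E ⨾ Γ ⊢ B
  conv refl d = d

  ∀₁-self : {Γ : List (LAF2 S)} {A : LAF2 S} →
            E ⨾ Γ ⊢ ∀₁ (tsub (liftσ ↑) A) → E ⨾ Γ ⊢ A
  ∀₁-self {A = A} d = conv (∀₁-instance-self A) (∀₁E d (var zero))

  ∀₂-self : {Γ : List (LAF2 S)} {k : ℕ} {s : Fam} {A : LAF2 S} →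
            E ⨾ Γ ⊢ ∀₂ k s (pren (liftρ k s (wk k s)) A) → E ⨾ Γ ⊢ A
  ∀₂-self {k = k} {s} {A} d =
    conv (∀₂-instance-self k s A) (∀₂E d (pvar k s zero))

  Valid : LAF2 S → Set
  Valid A = ∀ {Γ} → E ⨾ Γ ⊢ A

  Stable : LAF2 S → Set
  Stable A = Valid (¬ᶠ ¬ᶠ A ⇒ A)

  ¬¬-intro : {Γ : List (LAF2 S)} {A : LAF2 S} → E ⨾ Γ ⊢ A ⇒ ¬ᶠ ¬ᶠ A
  ¬¬-intro = ⇒I (⇒I (⇒E (hyp (here refl)) (hyp (there (here refl)))))

  ¬¬-map : {A B : LAF2 S} → Valid (A ⇒ B) → Valid (¬ᶠ ¬ᶠ A ⇒ ¬ᶠ ¬ᶠ B)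
  ¬¬-map f = ⇒I (⇒I (⇒E (hyp (there (here refl)))
                         (⇒I (⇒E (hyp (there (here refl))) (⇒E f (hyp (here refl)))))))

  ⊥-stable : Stable ⊥ᶠ
  ⊥-stable = ⇒I (⇒E (hyp (here refl)) (⇒I (hyp (here refl))))

  -- ¬¬(A → B), A ⊢ ¬¬B, and ¬¬B ⊢ B.
  ⇒-stable : {A B : LAF2 S} → Stable B → Stable (A ⇒ B)
  ⇒-stable stable-B = ⇒I (⇒I (⇒E stable-B
    (⇒I (⇒E (hyp (there (there (here refl))))
      (⇒I (⇒E (hyp (there (here refl)))
                (⇒E (hyp (here refl)) (hyp (there (there (here refl)))))))))))

  -- ¬¬∀x.A ⊢ ¬¬A ⊢ A with x fresh, then generalise.
  ∀₁-stable : {A : LAF2 S} → Stable A → Stable (∀₁ A)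
  ∀₁-stable stable-A =
    ⇒I (∀₁I (⇒E stable-A (⇒E (¬¬-map (⇒I (∀₁-self (hyp (here refl))))) (hyp (here refl)))))

  ∀₂-stable : {k : ℕ} {s : Fam} {A : LAF2 S} → Stable A → Stable (∀₂ k s A)
  ∀₂-stable stable-A =
    ⇒I (∀₂I (⇒E stable-A (⇒E (¬¬-map (⇒I (∀₂-self (hyp (here refl))))) (hyp (here refl)))))

data EndsIn⊥ {S : Signature} : LAF2 S → Set where
  bot  : EndsIn⊥ ⊥ᶠ
  imp  : ∀ {A B} → EndsIn⊥ B → EndsIn⊥ (A ⇒ B)
  all₁ : ∀ {A} → EndsIn⊥ A → EndsIn⊥ (∀₁ A)
  all₂ : ∀ {k s A} → EndsIn⊥ A → EndsIn⊥ (∀₂ k s A)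

stable : {E : Term S → Term S → Set} {F : LAF2 S} → EndsIn⊥ F → Stable {E = E} F
stable bot      = ⊥-stable
stable (imp b)  = ⇒-stable (stable b)
stable (all₁ b) = ∀₁-stable (stable b)
stable (all₂ b) = ∀₂-stable (stable b)

*-ends-⊥ : {G : LM2 S} → EndsWith⊥ G → EndsIn⊥ (G *)
*-ends-⊥ bot                = bot
*-ends-⊥ (imp b)            = imp (*-ends-⊥ b)
*-ends-⊥ (all₁ b)           = all₁ (*-ends-⊥ b)
*-ends-⊥ (all₂ {c = ord} b) = all₂ (*-ends-⊥ b)
*-ends-⊥ (all₂ {c = cls} b) = all₂ (*-ends-⊥ b)

*-ends-cls : {G : LM2 S} → EndsWithCls G → EndsIn⊥ (G *)
*-ends-cls var                = imp bot
*-ends-cls (imp b)            = imp (*-ends-cls b)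
*-ends-cls (all₁ b)           = all₁ (*-ends-cls b)
*-ends-cls (all₂ {c = ord} b) = all₂ (*-ends-cls b)
*-ends-cls (all₂ {c = cls} b) = all₂ (*-ends-cls b)

classical-* : {G : LM2 S} → ClassicalType G → EndsIn⊥ (G *)
classical-* (inj₁ b) = *-ends-⊥ b
classical-* (inj₂ b) = *-ends-cls b

lemma3p2 : (S : Signature) (E : Term S → Term S → Set) (G : LM2 S) →
    ClassicalType G →
    (E ⨾ [] ⊢ ¬ᶠ ¬ᶠ (G *) ⇒ (G *)) × (E ⨾ [] ⊢ (G *) ⇒ ¬ᶠ ¬ᶠ (G *))
lemma3p2 S E G classical = stable (classical-* classical) , ¬¬-intro
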